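{- Let $(\mathcal{T},\ll,\triangleright)$ be a regular clip and let $(i,s,\alpha,X),(j,t,\beta,Y),(k,u,\gamma,Z)\in\mathcal{T}$ be such that $(i,s,\alpha,X)\ll(j,t,\beta,Y)$, $(j,t,\beta,Y)\triangleright(k,u,\gamma,Z)$, and for every $(l,v,\delta,T)\in\mathcal{T}$, either not $(i,s,\alpha,X)\triangleright(l,v,\delta,T)$ or not $(l,v,\delta,T)\ll(k,u,\gamma,Z)$ (i.e. this triple is a defect of downward confluence). Then there is no $(l,v,\delta,T)\in\mathcal{T}$ with $(l,v,\delta,T)\ll(k,u,\gamma,Z)$.
   Context: Formulas over a countably infinite set of atoms: $A::=p\mid (A\rightarrow A)\mid \top\mid\bot\mid (A\wedge A)\mid (A\vee A)\mid \square A\mid \lozenge A$; $\neg A$ abbreviates $A\rightarrow\bot$. $\mathbf{LIK4}$ is the least set of formulas that is closed under uniform substitution, contains the standard axioms of intuitionistic propositional logic, is closed under modus ponens, contains the axioms $\square p\wedge\square q\rightarrow\square(p\wedge q)$, $\lozenge(p\vee q)\rightarrow\lozenge p\vee\lozenge q$, $\square\top$, $\neg\lozenge\bot$, $\square p\rightarrow\square\square p$, $\lozenge\lozenge p\rightarrow\lozenge p$, $\square(p\vee q)\rightarrow\lozenge p\vee\square q$, $\lozenge(p\rightarrow q)\rightarrow(\square p\rightarrow\lozenge q)$, and is closed under the rules: from $p\rightarrow q$ infer $\square p\rightarrow\square q$; from $p\rightarrow q$ infer $\lozenge p\rightarrow\lozenge q$. A theory is a set of formulas containing $\mathbf{LIK4}$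 closed under modus ponens; prime if it omits $\bot$ and $A\vee B\in s$ implies $A\in s$ or $B\in s$. $W_c$ is the set of prime theories, $s\leq_c t$ iff $s\subseteq t$, and $sR_ct$ iff for all formulas $A$, $\square A\in s\Rightarrow A\in t$ and $A\in t\Rightarrow\lozenge A\in s$. A tip is a 4-tuple $(i,s,\alpha,X)$ with $i,\alpha,X\in\mathbb{N}$ and $s\in W_c$. A clip is $(\mathcal{T},\ll,\triangleright)$ with $\mathcal{T}$ a finite nonempty set of tips and $\ll,\triangleright$ binary relations on $\mathcal{T}$. It is coherent if for all $(i,s,\alpha,X),(j,t,\beta,Y)\in\mathcal{T}$: if $i=j$ then $s=t$, $\alpha=\beta$, $X=Y$; if $(i,s,\alpha,X)\ll(j,t,\beta,Y)$ then $j\neq i$, $s\leq_c t$, $\beta=\alpha$, $Y=X+1$; if $(i,s,\alpha,X)\triangleright(j,t,\beta,Y)$ then $j\neq i$, $sR_ct$, $\beta=\alpha+1$, $Y=X$. A coherent clip is regular if for all $x,y,z\in\mathcal{T}$ with first components $i_x,i_y$: (a) $x\ll z$ and $y\ll z$ imply $i_x=i_y$; (b) $x\triangleright z$ and $y\triangleright z$ imply $i_x=i_y$; (c) if $x\triangleright y$ and $z\ll y$ then there is $w\in\mathcal{T}$ with $w\ll x$ and $w\triangleright z$. -}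

module Defs where

open import Data.Nat using (ℕ; suc; _+_)
open import Data.Product using (Σ; _×_; _,_; proj₁; proj₂; ∃)
open import Data.Sum using (_⊎_)
open import Data.List using (List; [])
open import Data.List.Membership.Propositional using (_∈_)
open import Relation.Nullary using (¬_)
open import Relation.Binary.PropositionalEquality using (_≡_)
open import Level using (0ℓ)

infixr 5 _⇒_
infixl 7 _∧_
infixl 6 _∨_
data Formula : Set where
  var : ℕ → Formula
  _⇒_ : Formula → Formula → Formula
  ⊤' ⊥' : Formula
  _∧_ _∨_ : Formula → Formula → Formula
  □ ◇ : Formula → Formula

¬' : Formula → Formula
¬' A = A ⇒ ⊥'

Subst : Set
Subst = ℕ → Formula

sub : Subst → Formula → Formula
sub σ (var n) = σ n
sub σ (A ⇒ B) = sub σ A ⇒ sub σ B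
sub σ ⊤' = ⊤'
sub σ ⊥' = ⊥'
sub σ (A ∧ B) = sub σ A ∧ sub σ B
sub σ (A ∨ B) = sub σ A ∨ sub σ B
sub σ (□ A) = □ (sub σ A)
sub σ (◇ A) = ◇ (sub σ A)

p q r : Formula
p = var 0
q = var 1
r = var 2

data Axiom : Formula → Set where
  ipc-k   : Axiom (p ⇒ (q ⇒ p))
  ipc-s   : Axiom ((p ⇒ (q ⇒ r)) ⇒ ((p ⇒ q) ⇒ (p ⇒ r)))
  ipc-∧e1 : Axiom (p ∧ q ⇒ p)
  ipc-∧e2 : Axiom (p ∧ q ⇒ q)
  ipc-∧i  : Axiom (p ⇒ (q ⇒ p ∧ q))
  ipc-∨i1 : Axiom (p ⇒ p ∨ q)
  ipc-∨i2 : Axiom (q ⇒ p ∨ q)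
  ipc-∨e  : Axiom ((p ⇒ r) ⇒ ((q ⇒ r) ⇒ (p ∨ q ⇒ r)))
  ipc-⊥   : Axiom (⊥' ⇒ p)
  ipc-⊤   : Axiom ⊤'
  ax-□∧   : Axiom (□ p ∧ □ q ⇒ □ (p ∧ q))
  ax-◇∨   : Axiom (◇ (p ∨ q) ⇒ ◇ p ∨ ◇ q)
  ax-□⊤   : Axiom (□ ⊤')
  ax-¬◇⊥  : Axiom (¬' (◇ ⊥'))
  ax-4□   : Axiom (□ p ⇒ □ (□ p))
  ax-4◇   : Axiom (◇ (◇ p) ⇒ ◇ p)
  ax-□∨   : Axiom (□ (p ∨ q) ⇒ ◇ p ∨ □ q)
  ax-◇⇒   : Axiom (◇ (p ⇒ q) ⇒ (□ p ⇒ ◇ q))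

data LIK4 : Formula → Set where
  axiom : ∀ {A} → Axiom A → LIK4 A
  subst : ∀ {A} (σ : Subst) → LIK4 A → LIK4 (sub σ A)
  mp    : ∀ {A B} → LIK4 (A ⇒ B) → LIK4 A → LIK4 B
  mon□  : ∀ {A B} → LIK4 (A ⇒ B) → LIK4 (□ A ⇒ □ B)
  mon◇  : ∀ {A B} → LIK4 (A ⇒ B) → LIK4 (◇ A ⇒ ◇ B)

FSet : Set₁
FSet = Formula → Set

IsTheory : FSet → Set
IsTheory s = (∀ A → LIK4 A → s A) × (∀ A B → s (A ⇒ B) → s A → s B)

IsPrime : FSet → Set
IsPrime s = IsTheory s × ¬ s ⊥' × (∀ A B → s (A ∨ B) → s A ⊎ s B)

Wc : Set₁
Wc = Σ FSet IsPrime

_≤c_ : Wc → Wc → Set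
s ≤c t = ∀ A → proj₁ s A → proj₁ t A

_Rc_ : Wc → Wc → Set
s Rc t = ∀ A → (proj₁ s (□ A) → proj₁ t A) × (proj₁ t A → proj₁ s (◇ A))

record Tip : Set₁ where
  constructor tip
  field
    idx : ℕ
    thy : Wc
    α   : ℕ
    X   : ℕ
open Tip public

record Clip : Set₂ where
  field
    tips     : List Tip
    nonempty : ¬ (tips ≡ [])
    _≪_      : Tip → Tip → Set
    _▷_      : Tip → Tip → Set
open Clip public

Coherent : Clip → Set₁
Coherent C =
    (∀ x y → x ∈ tips C → y ∈ tips C → idx x ≡ idx y →
       (thy x ≡ thy y) × (α x ≡ α y) × (X x ≡ X y))
  × (∀ x y → x ∈ tips C → y ∈ tips C → _≪_ C x y →
       ¬ (idx y ≡ idx x) × (thy x ≤c thy y) × (α y ≡ α x) × (X y ≡ suc (X x)))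
  × (∀ x y → x ∈ tips C → y ∈ tips C → _▷_ C x y →
       ¬ (idx y ≡ idx x) × (thy x Rc thy y) × (α y ≡ suc (α x)) × (X y ≡ X x))

Regular : Clip → Set₁
Regular C = Coherent C
  × (∀ x y z → x ∈ tips C → y ∈ tips C → z ∈ tips C →
       _≪_ C x z → _≪_ C y z → idx x ≡ idx y)
  × (∀ x y z → x ∈ tips C → y ∈ tips C → z ∈ tips C →
       _▷_ C x z → _▷_ C y z → idx x ≡ idx y)
  × (∀ x y z → x ∈ tips C → y ∈ tips C → z ∈ tips C →
       _▷_ C x y → _≪_ C z y →
       Σ Tip λ w → w ∈ tips C × _≪_ C w x × _▷_ C w z)

module Submission where

open import Defs
open import Data.Product using (Σ; _×_; _,_; proj₁; proj₂)
open import Data.List.Membership.Propositional using (_∈_)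
open import Relation.Nullary using (¬_)
open import Relation.Binary.PropositionalEquality using (_≡_; refl)

-- Given w ≪ z, regularity (c) applied to y ▷ z yields v with v ≪ y and v ▷ w.
-- By (a) and coherence a tip has at most one ≪-predecessor, so v = x, and then
-- x ▷ w ≪ z is precisely the square that the defect rules out.

tip-≡ : ∀ {a b} → idx a ≡ idx b → thy a ≡ thy b → α a ≡ α b → X a ≡ X b → a ≡ b
tip-≡ {tip i s a x} refl refl refl refl = refl

module _ (C : Clip) (regular : Regular C) where
  open Clip C using () renaming (_≪_ to _≪ᶜ_; _▷_ to _▷ᶜ_)

  idx-injective : ∀ {a b} → a ∈ tips C → b ∈ tips C → idx a ≡ idx b → a ≡ b
  idx-injective a∈ b∈ eq =
    let thy≡ , α≡ , X≡ = proj₁ (proj₁ regular) _ _ a∈ b∈ eq in tip-≡ eq thy≡ α≡ X≡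

  ≪-pred-unique : ∀ {a b c} → a ∈ tips C → b ∈ tips C → c ∈ tips C →
    a ≪ᶜ c → b ≪ᶜ c → a ≡ b
  ≪-pred-unique a∈ b∈ c∈ a≪c b≪c =
    idx-injective a∈ b∈ (proj₁ (proj₂ regular) _ _ _ a∈ b∈ c∈ a≪c b≪c)

  ▷-≪-square : ∀ {y z w} → y ∈ tips C → z ∈ tips C → w ∈ tips C →
    y ▷ᶜ z → w ≪ᶜ z → Σ Tip λ v → v ∈ tips C × v ≪ᶜ y × v ▷ᶜ w
  ▷-≪-square y∈ z∈ w∈ = proj₂ (proj₂ (proj₂ regular)) _ _ _ y∈ z∈ w∈

lemma26 : (C : Clip) → Regular C →
    (x y z : Tip) → x ∈ tips C → y ∈ tips C → z ∈ tips C →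
    _≪_ C x y → _▷_ C y z →
    (∀ w → w ∈ tips C → ¬ (_▷_ C x w × _≪_ C w z)) →
    ¬ (Σ Tip λ w → w ∈ tips C × _≪_ C w z)
lemma26 C regular x y z x∈ y∈ z∈ x≪y y▷z defect (w , w∈ , w≪z)
  with ▷-≪-square C regular y∈ z∈ w∈ y▷z w≪z
... | v , v∈ , v≪y , v▷w
  with ≪-pred-unique C regular v∈ x∈ y∈ v≪y x≪y
... | refl = defect w w∈ (v▷w , w≪z)
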